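{- Let $G=(U\cup W,E)$ be a circular graph. Then its neighbourhood graph $\mathcal{N}(G)$ is isomorphic to the disjoint union $G\cup G$ of two copies of $G$.
   Context: All graphs are finite and simple. For vertices $v_1,\dots,v_k$, $cn(v_1,\dots,v_k)$ denotes the number of common neighbours of $v_1,\dots,v_k$. A circular graph is a finite bipartite graph $G$ with a specified bipartition $V(G)=U\cup W$ ($U\cap W=\emptyset$, every edge joins $U$ to $W$) such that (i) $cn(u_i,u_j,u_k)=1$ for all distinct $u_i,u_j,u_k\in U$, and (ii) $d(w)\ge 3$ for every $w\in W$. For a graph $H$ with vertex set $V$, the neighbourhood graph $\mathcal{N}(H)$ has vertex set $V\cup\{N(v): v\in V\}$, where for each vertex $v$ a separate vertex $N(v)$ (representing the open neighbourhood of $v$) is introduced, so $\mathcal{N}(H)$ has $2|V|$ vertices; a vertex $x\in V$ is adjacent to $N(v)$ iff $x$ belongs to the open neighbourhood of $v$, and there are no other edges. -}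

module Defs where

open import Data.Nat using (ℕ; _≥_)
open import Data.Bool using (Bool; true; false; _∧_)
open import Data.Fin using (Fin)
open import Data.Sum using (_⊎_; inj₁; inj₂)
open import Data.List using (length; filterᵇ; allFin)
open import Data.Product using (Σ; _×_)
open import Relation.Binary.PropositionalEquality using (_≡_; _≢_)
open import Function.Bundles using (_↔_; Inverse)

record Graph (n : ℕ) : Set where
  field
    adj    : Fin n → Fin n → Bool
    sym    : ∀ x y → adj x y ≡ adj y x
    irrefl : ∀ x → adj x x ≡ false
open Graph public

deg : ∀ {n} → Graph n → Fin n → ℕ
deg {n} G v = length (filterᵇ (λ z → adj G v z) (allFin n))

cn3 : ∀ {n} → Graph n → Fin n → Fin n → Fin n → ℕ
cn3 {n} G a b c =
  length (filterᵇ (λ z → adj G a z ∧ adj G b z ∧ adj G c z) (allFin n))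

-- A circular graph: a graph with a specified bipartition V = U ∪ W,
-- encoded by inU v ≡ true iff v ∈ U (so W = complement of U).
record IsCircular {n : ℕ} (G : Graph n) (inU : Fin n → Bool) : Set where
  field
    bipartite : ∀ x y → adj G x y ≡ true → inU x ≢ inU y
    cn-one    : ∀ a b c → inU a ≡ true → inU b ≡ true → inU c ≡ true →
                a ≢ b → a ≢ c → b ≢ c → cn3 G a b c ≡ 1
    deg-W     : ∀ w → inU w ≡ false → deg G w ≥ 3

-- Neighbourhood graph N(G): vertex set V ⊎ {N(v) : v ∈ V}, where
-- inj₁ x is the vertex x and inj₂ v is the vertex N(v);
-- x ~ N(v) iff x ∈ N(v) iff x adjacent to v; no other edges.
nbhdAdj : ∀ {n} → Graph n → Fin n ⊎ Fin n → Fin n ⊎ Fin n → Bool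
nbhdAdj G (inj₁ x) (inj₁ y) = false
nbhdAdj G (inj₁ x) (inj₂ v) = adj G v x
nbhdAdj G (inj₂ v) (inj₁ x) = adj G v x
nbhdAdj G (inj₂ v) (inj₂ w) = false

unionAdj : ∀ {n} → Graph n → Fin n ⊎ Fin n → Fin n ⊎ Fin n → Bool
unionAdj G (inj₁ x) (inj₁ y) = adj G x y
unionAdj G (inj₁ x) (inj₂ y) = false
unionAdj G (inj₂ x) (inj₁ y) = false
unionAdj G (inj₂ x) (inj₂ y) = adj G x y

Isomorphic : {V V' : Set} → (V → V → Bool) → (V' → V' → Bool) → Set
Isomorphic {V} {V'} A B =
  Σ (V ↔ V') (λ f → ∀ x y → A x y ≡ B (Inverse.to f x) (Inverse.to f y))

-- For a bipartite graph with sides U and W, the map sending x ∈ U to the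
-- first copy and N(x) to the second, and x ∈ W to the second copy and N(x)
-- to the first, is an isomorphism N(G) ≅ G ∪ G: an edge x ~ N(v) of N(G)
-- joins vertices of different sides, so both ends land in the same copy,
-- while pairs x, y (or N(x), N(y)) of N(G) are never adjacent and land in
-- the same copy only when x and y lie on the same side, hence are not
-- adjacent in G either.
module Submission where

open import Defs
open import Data.Nat using (ℕ)
open import Data.Bool using (Bool; true; false)
open import Data.Fin using (Fin)
open import Data.Sum using (_⊎_; inj₁; inj₂)
open import Data.Empty using (⊥-elim)
open import Data.Product using (_,_)
open import Relation.Binary.PropositionalEquality using (_≡_; _≢_; refl; trans)
  renaming (sym to ≡-sym)
open import Function.Bundles using (mk↔ₛ′)

module _ {n : ℕ} (G : Graph n) (side : Fin n → Bool)
         (bipartite : ∀ x y → adj G x y ≡ true → side x ≢ side y) where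

  adj-sameSide : ∀ x y → side x ≡ side y → adj G x y ≡ false
  adj-sameSide x y eq with adj G x y in xy
  ... | true  = ⊥-elim (bipartite x y xy eq)
  ... | false = refl

  vertexCopy : Bool → Fin n → Fin n ⊎ Fin n
  vertexCopy true  x = inj₁ x
  vertexCopy false x = inj₂ x

  nbhdCopy : Bool → Fin n → Fin n ⊎ Fin n
  nbhdCopy true  x = inj₂ x
  nbhdCopy false x = inj₁ x

  toUnion : Fin n ⊎ Fin n → Fin n ⊎ Fin n
  toUnion (inj₁ x) = vertexCopy (side x) x
  toUnion (inj₂ x) = nbhdCopy (side x) x

  toUnion-involutive : ∀ z → toUnion (toUnion z) ≡ z
  toUnion-involutive (inj₁ x) with side x in sx
  ... | true  rewrite sx = refl
  ... | false rewrite sx = refl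
  toUnion-involutive (inj₂ x) with side x in sx
  ... | true  rewrite sx = refl
  ... | false rewrite sx = refl

  toUnion-homomorphic : ∀ a b → nbhdAdj G a b ≡ unionAdj G (toUnion a) (toUnion b)
  toUnion-homomorphic (inj₁ x) (inj₁ y) with side x in sx | side y in sy
  ... | true  | true  = ≡-sym (adj-sameSide x y (trans sx (≡-sym sy)))
  ... | true  | false = refl
  ... | false | true  = refl
  ... | false | false = ≡-sym (adj-sameSide x y (trans sx (≡-sym sy)))
  toUnion-homomorphic (inj₁ x) (inj₂ y) with side x in sx | side y in sy
  ... | true  | true  = adj-sameSide y x (trans sy (≡-sym sx))
  ... | true  | false = Graph.sym G y x
  ... | false | true  = Graph.sym G y x
  ... | false | false = adj-sameSide y x (trans sy (≡-sym sx))
  toUnion-homomorphic (inj₂ x) (inj₁ y) with side x in sx | side y in sy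
  ... | true  | true  = adj-sameSide x y (trans sx (≡-sym sy))
  ... | true  | false = refl
  ... | false | true  = refl
  ... | false | false = adj-sameSide x y (trans sx (≡-sym sy))
  toUnion-homomorphic (inj₂ x) (inj₂ y) with side x in sx | side y in sy
  ... | true  | true  = ≡-sym (adj-sameSide x y (trans sx (≡-sym sy)))
  ... | true  | false = refl
  ... | false | true  = refl
  ... | false | false = ≡-sym (adj-sameSide x y (trans sx (≡-sym sy)))

  bipartite⇒nbhd≅union : Isomorphic (nbhdAdj G) (unionAdj G)
  bipartite⇒nbhd≅union =
    mk↔ₛ′ toUnion toUnion toUnion-involutive toUnion-involutive , toUnion-homomorphic

proposition2p8 : ∀ {n : ℕ} (G : Graph n) (inU : Fin n → Bool) →
                 IsCircular G inU → Isomorphic (nbhdAdj G) (unionAdj G)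
proposition2p8 G inU circular = bipartite⇒nbhd≅union G inU (IsCircular.bipartite circular)
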